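{- Let $(U_n(x))_{n\ge0}$ be the polynomials defined by $U_0(x)=0$, $U_1(x)=1$ and $U_{n+1}(x)=2x\,U_n(x)-U_{n-1}(x)$ for $n\ge1$. For arbitrary non-negative integers $m,p,q$ with $m>p$, $$U_m(x)\cdot\begin{vmatrix} U_p(x)&U_{p+1}(x)\\ U_{q}(x)&U_{q+1}(x)\end{vmatrix}=\begin{vmatrix} U_{p}(x)&U_{m+p}(x)\\ U_{q}(x)&U_{m+q}(x)\end{vmatrix}.$$
   Context: $\begin{vmatrix}p&q\\ r&s\end{vmatrix}$ denotes the $2\times 2$ determinant $ps-qr$. In this paper the Chebyshev polynomials of the second kind are indexed so that $U_0=0$, $U_1=1$ (i.e. the paper's $U_n$ is the classical $U_{n-1}$). -}

module Defs where

open import Level using (Level)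
open import Data.Nat using (ℕ; zero; suc)
open import Algebra.Bundles using (CommutativeRing)

-- Chebyshev polynomials of the second kind, paper's indexing:
-- U 0 = 0, U 1 = 1, U (n+1) = 2x U n - U (n-1), evaluated at an element x
-- of an arbitrary commutative ring R (taking R = ℤ[x], x = X recovers the
-- polynomial identity).
module Cheb {c ℓ : Level} (R : CommutativeRing c ℓ) where
  open CommutativeRing R

  U : Carrier → ℕ → Carrier
  U x zero = 0#
  U x (suc zero) = 1#
  U x (suc (suc n)) = ((1# + 1#) * x) * U x (suc n) - U x n

  det2 : Carrier → Carrier → Carrier → Carrier → Carrier
  det2 p q r s = p * s - q * r

-- For fixed p and q both sides are linear in the sequence (U n), shifted by
-- m, so as functions of m they solve the recurrence f (m+2) = 2x f (m+1) - f m.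
-- They agree at m = 0 (both vanish) and at m = 1, hence everywhere.
module Submission where

open import Defs
open import Data.Nat using (ℕ; zero; suc; _>_)
import Data.Nat as ℕ
open import Data.Nat.Properties using (+-comm)
open import Algebra.Bundles using (CommutativeRing)

module SecondOrderRecurrence {c ℓ} (R : CommutativeRing c ℓ) (t : CommutativeRing.Carrier R) where
  open CommutativeRing R
  open import Algebra.Properties.Ring ring using (x[y-z]≈xy-xz)
  open import Algebra.Properties.AbelianGroup +-abelianGroup using (⁻¹-∙-comm)
  open import Algebra.Properties.CommutativeSemigroup +-commutativeSemigroup using (interchange)
  open import Algebra.Properties.CommutativeSemigroup *-commutativeSemigroup using (x∙yz≈y∙xz)
  open import Relation.Binary.Reasoning.Setoid setoid

  IsSolution : (ℕ → Carrier) → Set ℓ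
  IsSolution f = ∀ n → f (suc (suc n)) ≈ t * f (suc n) - f n

  solution-unique : ∀ {f g} → IsSolution f → IsSolution g →
                    f 0 ≈ g 0 → f 1 ≈ g 1 → ∀ n → f n ≈ g n
  solution-unique sf sg f0≈g0 f1≈g1 zero = f0≈g0
  solution-unique sf sg f0≈g0 f1≈g1 (suc zero) = f1≈g1
  solution-unique {f} {g} sf sg f0≈g0 f1≈g1 (suc (suc n)) = begin
    f (suc (suc n))        ≈⟨ sf n ⟩
    t * f (suc n) - f n    ≈⟨ +-cong (*-congˡ (unique (suc n))) (-‿cong (unique n)) ⟩
    t * g (suc n) - g n    ≈⟨ sg n ⟨
    g (suc (suc n))        ∎
    where unique = solution-unique sf sg f0≈g0 f1≈g1

  shift-isSolution : ∀ {f} → IsSolution f → ∀ k → IsSolution (λ n → f (n ℕ.+ k))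
  shift-isSolution sf k n = sf (n ℕ.+ k)

  *ˡ-isSolution : ∀ {f} → IsSolution f → ∀ a → IsSolution (λ n → a * f n)
  *ˡ-isSolution {f} sf a n = begin
    a * f (suc (suc n))              ≈⟨ *-congˡ (sf n) ⟩
    a * (t * f (suc n) - f n)        ≈⟨ x[y-z]≈xy-xz a _ _ ⟩
    a * (t * f (suc n)) - a * f n    ≈⟨ +-congʳ (x∙yz≈y∙xz a t (f (suc n))) ⟩
    t * (a * f (suc n)) - a * f n    ∎

  *ʳ-isSolution : ∀ {f} → IsSolution f → ∀ a → IsSolution (λ n → f n * a)
  *ʳ-isSolution {f} sf a n = begin
    f (suc (suc n)) * a              ≈⟨ *-comm _ a ⟩
    a * f (suc (suc n))              ≈⟨ *ˡ-isSolution sf a n ⟩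
    t * (a * f (suc n)) - a * f n    ≈⟨ +-cong (*-congˡ (*-comm a _)) (-‿cong (*-comm a _)) ⟩
    t * (f (suc n) * a) - f n * a    ∎

  [x-y]-[z-w]≈[x-z]-[y-w] : ∀ x y z w → (x - y) - (z - w) ≈ (x - z) - (y - w)
  [x-y]-[z-w]≈[x-z]-[y-w] x y z w = begin
    (x - y) + - (z - w)       ≈⟨ +-congˡ (⁻¹-∙-comm z (- w)) ⟨
    (x - y) + (- z + - - w)   ≈⟨ interchange x (- y) (- z) (- - w) ⟩
    (x - z) + (- y + - - w)   ≈⟨ +-congˡ (⁻¹-∙-comm y (- w)) ⟩
    (x - z) + - (y - w)       ∎

  -‿isSolution : ∀ {f g} → IsSolution f → IsSolution g → IsSolution (λ n → f n - g n)
  -‿isSolution {f} {g} sf sg n = begin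
    f (suc (suc n)) - g (suc (suc n))                ≈⟨ +-cong (sf n) (-‿cong (sg n)) ⟩
    (t * f (suc n) - f n) - (t * g (suc n) - g n)    ≈⟨ [x-y]-[z-w]≈[x-z]-[y-w] _ _ _ _ ⟩
    (t * f (suc n) - t * g (suc n)) - (f n - g n)    ≈⟨ +-congʳ (x[y-z]≈xy-xz t _ _) ⟨
    t * (f (suc n) - g (suc n)) - (f n - g n)        ∎

module Chebyshev {c ℓ} (R : CommutativeRing c ℓ) (x : CommutativeRing.Carrier R) where
  open CommutativeRing R
  open Cheb R
  open SecondOrderRecurrence R ((1# + 1#) * x)
  open import Relation.Binary.Reasoning.Setoid setoid

  U-isSolution : IsSolution (U x)
  U-isSolution n = refl

  det2-col₂-isSolution : ∀ a b {f g} → IsSolution f → IsSolution g →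
                     IsSolution (λ n → det2 a (f n) b (g n))
  det2-col₂-isSolution a b sf sg = -‿isSolution (*ˡ-isSolution sg a) (*ʳ-isSolution sf b)

  U*det2≈det2-shift : ∀ m p q →
    U x m * det2 (U x p) (U x (suc p)) (U x q) (U x (suc q))
      ≈ det2 (U x p) (U x (m ℕ.+ p)) (U x q) (U x (m ℕ.+ q))
  U*det2≈det2-shift m p q = solution-unique
    (*ʳ-isSolution U-isSolution _)
    (det2-col₂-isSolution (U x p) (U x q) (shift-isSolution U-isSolution p) (shift-isSolution U-isSolution q))
    (trans (zeroˡ _) (sym (-‿inverseʳ _)))
    (*-identityˡ _)
    m

open import Data.Nat using (_+_)

mainTheorem8 : ∀ {c ℓ} (R : CommutativeRing c ℓ) (x : CommutativeRing.Carrier R) (m p q : ℕ) → m > p → CommutativeRing._≈_ R (CommutativeRing._*_ R (Cheb.U R x m) (Cheb.det2 R (Cheb.U R x p) (Cheb.U R x (p + 1)) (Cheb.U R x q) (Cheb.U R x (q + 1)))) (Cheb.det2 R (Cheb.U R x p) (Cheb.U R x (m + p)) (Cheb.U R x q) (Cheb.U R x (m + q)))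
mainTheorem8 R x m p q _ rewrite +-comm p 1 | +-comm q 1 = Chebyshev.U*det2≈det2-shift R x m p q
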